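{- Let $\boxtimes$ denote either the normal product $\boxtimes_{\min}$ or the strong product $\boxtimes_{\max}$. Let $H$ be a thin hypergraph. If $e\in E(H)$ is not dispensable in $H$, then $e$ is Cartesian with respect to any factorization $H\cong H_1\boxtimes H_2$ of $H$.
   Context: All hypergraphs $H=(V,E)$ are finite ($E$ a set of nonempty subsets of $V$), simple ($|e|\ge2$ for all edges, no edge properly contained in another) and connected. $N[v]$ is $v$ together with all vertices sharing an edge with $v$; $H$ is thin if $N[u]\ne N[v]$ for distinct $u,v$. An edge $e$ is dispensable if there are a vertex $z$ and distinct $x,y\in e$ with (1) $N[x]\cap N[y]\subsetneq N[x]\cap N[z]$ or $N[x]\subsetneq N[z]\subsetneq N[y]$, and (2) $N[x]\cap N[y]\subsetneq N[y]\cap N[z]$ or $N[y]\subsetneq N[z]\subsetneq N[x]$. Products of $H_1=(V_1,E_1)$, $H_2=(V_2,E_2)$ have vertex set $V_1\times V_2$ with projections $p_1,p_2$. Cartesian product: $e$ is an edge iff for some $\{i,j\}=\{1,2\}$, $p_i(e)\in E_i$ and $|p_j(e)|=1$. Strong product $\boxtimes_{\max}$: $e$ is an edge iff it is an edge of the Cartesian product, or $p_i(e)\in E_i$ for $i=1,2$ and $|e|=\max_i|p_i(e)|$. Normal product $\boxtimes_{\min}$: $e$ is an edge iff it is an edge of the Cartesian product, or there are $e_i\in E_i$ with $p_i(e)\subseteq e_i$ ($i=1,2$) and $|e|=|p_1(e)|=|p_2(e)|=\min\{|e_1|,|e_2|\}$. An edge of $H_1\boxtimes H_2$ is Cartesian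 w.r.t. this factorization if it is an edge of $H_1\Box H_2$ (transported via the isomorphism $H\cong H_1\boxtimes H_2$). -}

module Defs where

open import Data.Nat using (ℕ; _*_; _≤_; _⊔_; _⊓_)
open import Data.Fin using (Fin; remQuot; _≟_)
open import Data.Fin.Properties using (any?)
open import Data.Fin.Subset using (Subset; _∈_; ∣_∣) renaming (_⊆_ to _⊆ˢ_)
open import Data.Fin.Subset.Properties using (_∈?_)
open import Data.Vec using (tabulate)
open import Data.Product using (Σ; ∃; ∃-syntax; _×_; _,_; proj₁; proj₂)
open import Data.Product.Properties using ()
open import Relation.Nullary.Decidable using (⌊_⌋; _×-dec_)
open import Data.Sum using (_⊎_)
open import Relation.Nullary using (¬_)
open import Relation.Binary.PropositionalEquality using (_≡_; _≢_)
open import Relation.Unary using (Pred; _∩_; _⊂_; _⊆_)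
open import Function.Bundles using (_↔_; Inverse)

record Hypergraph (n : ℕ) : Set₁ where
  field
    Edge : Subset n → Set
open Hypergraph public

Simple : ∀ {n} → Hypergraph n → Set
Simple H = (∀ e → Edge H e → 2 ≤ ∣ e ∣)
         × (∀ e f → Edge H e → Edge H f → e ⊆ˢ f → e ≡ f)

data Reach {n} (H : Hypergraph n) (u : Fin n) : Fin n → Set where
  here : Reach H u u
  step : ∀ {v w} → Reach H u v → (e : Subset n) → Edge H e → v ∈ e → w ∈ e
       → Reach H u w

Connected : ∀ {n} → Hypergraph n → Set
Connected {n} H = ∀ (u v : Fin n) → Reach H u v

IsHypergraph : ∀ {n} → Hypergraph n → Set
IsHypergraph H = Simple H × Connected H

N[_]_ : ∀ {n} → Fin n → Hypergraph n → Pred (Fin n) _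
(N[ v ] H) w = v ≡ w ⊎ ∃[ e ] (Edge H e × v ∈ e × w ∈ e)

SameN : ∀ {n} → Hypergraph n → Fin n → Fin n → Set
SameN H u v = (N[ u ] H) ⊆ (N[ v ] H) × (N[ v ] H) ⊆ (N[ u ] H)

Thin : ∀ {n} → Hypergraph n → Set
Thin {n} H = ∀ (u v : Fin n) → u ≢ v → ¬ SameN H u v

Dispensable : ∀ {n} → Hypergraph n → Subset n → Set
Dispensable {n} H e =
  Σ (Fin n) λ z → Σ (Fin n) λ x → Σ (Fin n) λ y →
    x ∈ e × y ∈ e × x ≢ y ×
    (((N[ x ] H ∩ N[ y ] H) ⊂ (N[ x ] H ∩ N[ z ] H))
       ⊎ (N[ x ] H ⊂ N[ z ] H × N[ z ] H ⊂ N[ y ] H)) ×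
    (((N[ x ] H ∩ N[ y ] H) ⊂ (N[ y ] H ∩ N[ z ] H))
       ⊎ (N[ y ] H ⊂ N[ z ] H × N[ z ] H ⊂ N[ x ] H))

-- Products.  The vertex set V₁ × V₂ = Fin n₁ × Fin n₂ is encoded as
-- Fin (n₁ * n₂) via the standard bijection remQuot (inverse: combine).

module _ (n₁ n₂ : ℕ) where
  p₁ : Subset (n₁ * n₂) → Subset n₁
  p₁ e = tabulate λ a → ⌊ any? (λ v → (v ∈? e) ×-dec (proj₁ (remQuot {n₁} n₂ v) ≟ a)) ⌋

  p₂ : Subset (n₁ * n₂) → Subset n₂
  p₂ e = tabulate λ b → ⌊ any? (λ v → (v ∈? e) ×-dec (proj₂ (remQuot {n₁} n₂ v) ≟ b)) ⌋

_□_ : ∀ {n₁ n₂} → Hypergraph n₁ → Hypergraph n₂ → Hypergraph (n₁ * n₂)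
Edge (_□_ {n₁} {n₂} H₁ H₂) e = (Edge H₁ (p₁ n₁ n₂ e) × ∣ p₂ n₁ n₂ e ∣ ≡ 1)
                 ⊎ (Edge H₂ (p₂ n₁ n₂ e) × ∣ p₁ n₁ n₂ e ∣ ≡ 1)

_⊠max_ : ∀ {n₁ n₂} → Hypergraph n₁ → Hypergraph n₂ → Hypergraph (n₁ * n₂)
Edge (_⊠max_ {n₁} {n₂} H₁ H₂) e = Edge (H₁ □ H₂) e
  ⊎ (Edge H₁ (p₁ n₁ n₂ e) × Edge H₂ (p₂ n₁ n₂ e) × ∣ e ∣ ≡ ∣ p₁ n₁ n₂ e ∣ ⊔ ∣ p₂ n₁ n₂ e ∣)

_⊠min_ : ∀ {n₁ n₂} → Hypergraph n₁ → Hypergraph n₂ → Hypergraph (n₁ * n₂)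
Edge (_⊠min_ {n₁} {n₂} H₁ H₂) e = Edge (H₁ □ H₂) e
  ⊎ (Σ (Subset _) λ e₁ → Σ (Subset _) λ e₂ →
       Edge H₁ e₁ × Edge H₂ e₂ × p₁ n₁ n₂ e ⊆ˢ e₁ × p₂ n₁ n₂ e ⊆ˢ e₂ ×
       ∣ e ∣ ≡ ∣ p₁ n₁ n₂ e ∣ × ∣ e ∣ ≡ ∣ p₂ n₁ n₂ e ∣ × ∣ e ∣ ≡ ∣ e₁ ∣ ⊓ ∣ e₂ ∣)

data ProductKind : Set where
  normal strong : ProductKind

product : ProductKind → ∀ {n₁ n₂} → Hypergraph n₁ → Hypergraph n₂ → Hypergraph (n₁ * n₂)
product normal H₁ H₂ = H₁ ⊠min H₂
product strong H₁ H₂ = H₁ ⊠max H₂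

image : ∀ {n m} → (Fin n ↔ Fin m) → Subset n → Subset m
image σ e = tabulate λ j → ⌊ Inverse.from σ j ∈? e ⌋

IsIso : ∀ {n m} → Hypergraph n → Hypergraph m → (Fin n ↔ Fin m) → Set
IsIso H H' σ = ∀ e → (Edge H e → Edge H' (image σ e)) × (Edge H' (image σ e) → Edge H e)

-- Write (a , b) for a vertex of H₁ ⊠ H₂. In both the normal and the strong product the closed
-- neighbourhood of (a , b) is the rectangle N[a] × N[b]: adjacent pairs of factor vertices can
-- always be joined by a diagonal edge obtained by zipping enumerations of two factor edges. Hence
-- thinness of H passes to both factors. A non-Cartesian edge e projects onto sets of size at least
-- two in both factors, so it contains x = (a₁ , b₁) and y = (a₂ , b₂) with a₁ ≠ a₂ and b₁ ≠ b₂.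
-- Since N[a₁] ≠ N[a₂] and N[b₁] ≠ N[b₂], comparing the rectangles N[x] and N[y] with the
-- rectangle of one of the corners (a₁ , b₂), (a₂ , b₁) yields the strict inclusions that make e
-- dispensable.

module Submission where

open import Defs
open import Data.Bool.Properties using (T-≡)
open import Data.Empty using (⊥-elim)
open import Data.Fin using (Fin; combine; remQuot; _≟_)
open import Data.Fin.Properties using (any?; remQuot-combine; combine-remQuot; combine-injective)
open import Data.Fin.Subset using (Subset; ∣_∣; ⁅_⁆; _∪_; _∈_; _∉_; inside; outside)
  renaming (_⊆_ to _⊆ˢ_; ⊥ to ∅)
open import Data.Fin.Subset.Properties
  using (_∈?_; ⊆-antisym; ∉⊥; x∈⁅x⁆; x∈⁅y⁆⇒x≡y; x∈p∪q⁺; x∈p∪q⁻; ∪-identityˡ; p⊆q⇒∣p∣≤∣q∣; ∣⊥∣≡0; ∣⁅x⁆∣≡1)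
open import Data.List using (List; []; _∷_; length; map; filter; allFin; zip; alignWith)
open import Data.List.Properties using (length-map; length-zipWith; length-alignWith)
open import Data.List.Membership.Propositional using () renaming (_∈_ to _∈ₗ_)
open import Data.List.Membership.Propositional.Properties
  using (∈-map⁺; ∈-map⁻; ∈-filter⁺; ∈-filter⁻; ∈-allFin)
open import Data.List.Relation.Unary.Any using (here; there)
open import Data.List.Relation.Unary.All as All using (All)
open import Data.List.Relation.Unary.All.Properties using (All¬⇒¬Any)
open import Data.List.Relation.Unary.AllPairs as AllPairs using (_∷_; [])
open import Data.List.Relation.Unary.Unique.Propositional using (Unique)
import Data.List.Relation.Unary.Unique.Propositional.Properties as Unique
open import Data.Nat using (ℕ; suc; _*_; _≤_; _⊔_; _⊓_; s≤s)
open import Data.Nat.Properties using (⊓-glb)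
open import Data.Product as Product using (∃; ∃₂; _×_; _,_; proj₁; proj₂; uncurry)
open import Data.Sum as Sum using (_⊎_; inj₁; inj₂; [_,_]′)
open import Data.These using (foldWithDefaults)
open import Data.Vec using (_∷_; here; there; tabulate; lookup)
open import Data.Vec.Properties using (lookup∘tabulate; []=⇒lookup; lookup⇒[]=)
open import Function using (_∘_; flip; _↔_; Inverse; Equivalence)
open import Level using (0ℓ)
open import Relation.Nullary using (¬_; yes; no)
open import Relation.Nullary.Decidable
  using (⌊_⌋; isYes≗does; dec-true; toWitness; _×-dec_; ¬?; ¬¬-excluded-middle)
open import Relation.Nullary.Negation using (contradiction)
open import Relation.Unary using (Pred; Decidable; Satisfiable; _∩_; _⊆_; _⊂_; _≐_)
open import Relation.Unary.Properties using (≐-refl; ≐-sym; ≐-trans; ⊂-respˡ-≐; ⊂-respʳ-≐)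
open import Relation.Binary.PropositionalEquality
  using (_≡_; _≢_; refl; sym; trans; cong; cong₂; subst; subst₂; module ≡-Reasoning)

subset : ∀ {n} {P : Pred (Fin n) 0ℓ} → Decidable P → Subset n
subset P? = tabulate (λ i → ⌊ P? i ⌋)

module _ {n} {P : Pred (Fin n) 0ℓ} (P? : Decidable P) where

  ∈-subset⁺ : ∀ {i} → P i → i ∈ subset P?
  ∈-subset⁺ {i} p =
    lookup⇒[]= i _ (trans (lookup∘tabulate _ i) (trans (isYes≗does (P? i)) (dec-true (P? i) p)))

  ∈-subset⁻ : ∀ {i} → i ∈ subset P? → P i
  ∈-subset⁻ {i} i∈ =
    toWitness (Equivalence.from T-≡ (trans (sym (lookup∘tabulate _ i)) ([]=⇒lookup i∈)))

fromList : ∀ {n} → List (Fin n) → Subset n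
fromList []       = ∅
fromList (x ∷ xs) = ⁅ x ⁆ ∪ fromList xs

∈-fromList⁺ : ∀ {n} {xs : List (Fin n)} {i} → i ∈ₗ xs → i ∈ fromList xs
∈-fromList⁺ {xs = x ∷ _} (here refl) = x∈p∪q⁺ (inj₁ (x∈⁅x⁆ x))
∈-fromList⁺ {xs = _ ∷ _} (there i∈)  = x∈p∪q⁺ (inj₂ (∈-fromList⁺ i∈))

∈-fromList⁻ : ∀ {n} {xs : List (Fin n)} {i} → i ∈ fromList xs → i ∈ₗ xs
∈-fromList⁻ {xs = []}     i∈ = contradiction i∈ ∉⊥
∈-fromList⁻ {xs = x ∷ xs} i∈ with x∈p∪q⁻ ⁅ x ⁆ (fromList xs) i∈
... | inj₁ i∈⁅x⁆ = here (x∈⁅y⁆⇒x≡y x i∈⁅x⁆)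
... | inj₂ i∈xs  = there (∈-fromList⁻ i∈xs)

∣⁅x⁆∪p∣≡1+∣p∣ : ∀ {n} (x : Fin n) (p : Subset n) → x ∉ p → ∣ ⁅ x ⁆ ∪ p ∣ ≡ suc ∣ p ∣
∣⁅x⁆∪p∣≡1+∣p∣ Fin.zero    (inside  ∷ p) x∉p = contradiction here x∉p
∣⁅x⁆∪p∣≡1+∣p∣ Fin.zero    (outside ∷ p) x∉p = cong (suc ∘ ∣_∣) (∪-identityˡ p)
∣⁅x⁆∪p∣≡1+∣p∣ (Fin.suc x) (inside  ∷ p) x∉p = cong suc (∣⁅x⁆∪p∣≡1+∣p∣ x p (x∉p ∘ there))
∣⁅x⁆∪p∣≡1+∣p∣ (Fin.suc x) (outside ∷ p) x∉p = ∣⁅x⁆∪p∣≡1+∣p∣ x p (x∉p ∘ there)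

∣fromList∣≡length : ∀ {n} {xs : List (Fin n)} → Unique xs → ∣ fromList xs ∣ ≡ length xs
∣fromList∣≡length {n} {[]}     []           = ∣⊥∣≡0 n
∣fromList∣≡length {xs = x ∷ xs} (x∉xs ∷ xs!) =
  trans (∣⁅x⁆∪p∣≡1+∣p∣ x (fromList xs) (All¬⇒¬Any x∉xs ∘ ∈-fromList⁻))
        (cong suc (∣fromList∣≡length xs!))

record Enumerates {n} (s : Subset n) (xs : List (Fin n)) : Set where
  field
    unique   : Unique xs
    complete : ∀ {i} → i ∈ s → i ∈ₗ xs
    sound    : ∀ {i} → i ∈ₗ xs → i ∈ s
open Enumerates

∣s∣≡length : ∀ {n} {s : Subset n} {xs} → Enumerates s xs → ∣ s ∣ ≡ length xs
∣s∣≡length en =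
  trans (cong ∣_∣ (⊆-antisym (∈-fromList⁺ ∘ complete en) (sound en ∘ ∈-fromList⁻)))
        (∣fromList∣≡length (unique en))

enumerate : ∀ {n} (s : Subset n) → Enumerates s (filter (_∈? s) (allFin n))
enumerate {n} s = record
  { unique   = Unique.filter⁺ (_∈? s) (Unique.allFin⁺ n)
  ; complete = ∈-filter⁺ (_∈? s) (∈-allFin _)
  ; sound    = proj₂ ∘ ∈-filter⁻ (_∈? s) {xs = allFin n}
  }

enumerate-from : ∀ {n} {s : Subset n} {a a'} → a ∈ s → a' ∈ s → a ≢ a' →
  ∃ λ rest → Enumerates s (a ∷ a' ∷ rest)
enumerate-from {n} {s} {a} {a'} a∈s a'∈s a≢a' = filter Rest? (allFin n) , record
  { unique   = (a≢a' All.∷ All.tabulate (λ i∈ → proj₁ (proj₂ (rest i∈)) ∘ sym))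
               ∷ All.tabulate (λ i∈ → proj₂ (proj₂ (rest i∈)) ∘ sym)
               ∷ Unique.filter⁺ Rest? (Unique.allFin⁺ n)
  ; complete = complete′
  ; sound    = sound′
  }
  where
  Rest? : Decidable λ i → i ∈ s × i ≢ a × i ≢ a'
  Rest? i = (i ∈? s) ×-dec ¬? (i ≟ a) ×-dec ¬? (i ≟ a')
  rest : ∀ {i} → i ∈ₗ filter Rest? (allFin n) → i ∈ s × i ≢ a × i ≢ a'
  rest = proj₂ ∘ ∈-filter⁻ Rest? {xs = allFin n}
  complete′ : ∀ {i} → i ∈ s → i ∈ₗ a ∷ a' ∷ filter Rest? (allFin n)
  complete′ {i} i∈s with i ≟ a | i ≟ a'
  ... | yes refl | _        = here refl
  ... | no _     | yes refl = there (here refl)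
  ... | no i≢a   | no i≢a'  = there (there (∈-filter⁺ Rest? (∈-allFin i) (i∈s , i≢a , i≢a')))
  sound′ : ∀ {i} → i ∈ₗ a ∷ a' ∷ filter Rest? (allFin n) → i ∈ s
  sound′ (here refl)         = a∈s
  sound′ (there (here refl)) = a'∈s
  sound′ (there (there i∈))  = proj₁ (rest i∈)

two-members⇒2≤∣p∣ : ∀ {n} {p : Subset n} {i j} → i ∈ p → j ∈ p → i ≢ j → 2 ≤ ∣ p ∣
two-members⇒2≤∣p∣ {p = p} {i} {j} i∈p j∈p i≢j =
  subst (_≤ ∣ p ∣) (∣fromList∣≡length {xs = i ∷ j ∷ []} ((i≢j All.∷ All.[]) ∷ All.[] ∷ []))
        (p⊆q⇒∣p∣≤∣q∣ ij⊆p)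
  where
  ij⊆p : fromList (i ∷ j ∷ []) ⊆ˢ p
  ij⊆p k∈ with ∈-fromList⁻ {xs = i ∷ j ∷ []} k∈
  ... | here refl         = i∈p
  ... | there (here refl) = j∈p

∣p∣≡1⇒x≡y : ∀ {n} {p : Subset n} {i j} → ∣ p ∣ ≡ 1 → i ∈ p → j ∈ p → i ≡ j
∣p∣≡1⇒x≡y {i = i} {j} ∣p∣≡1 i∈p j∈p with i ≟ j
... | yes i≡j = i≡j
... | no  i≢j with subst (2 ≤_) ∣p∣≡1 (two-members⇒2≤∣p∣ i∈p j∈p i≢j)
...   | s≤s ()

2≤∣p∣⇒two-members : ∀ {n} {p : Subset n} → 2 ≤ ∣ p ∣ → ∃₂ λ i j → i ∈ p × j ∈ p × i ≢ j
2≤∣p∣⇒two-members {p = p} 2≤∣p∣ =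
  members _ (enumerate p) (subst (2 ≤_) (∣s∣≡length (enumerate p)) 2≤∣p∣)
  where
  members : ∀ xs → Enumerates p xs → 2 ≤ length xs → ∃₂ λ i j → i ∈ p × j ∈ p × i ≢ j
  members (i ∷ j ∷ _) en _ =
    i , j , sound en (here refl) , sound en (there (here refl)) , All.head (AllPairs.head (unique en))
  members (_ ∷ []) _ (s≤s ())

2≤∣p∣⇒member-≢ : ∀ {n} {p : Subset n} → 2 ≤ ∣ p ∣ → ∀ j → ∃ λ i → i ∈ p × i ≢ j
2≤∣p∣⇒member-≢ 2≤∣p∣ j with 2≤∣p∣⇒two-members 2≤∣p∣
... | i , i' , i∈p , i'∈p , i≢i' with i ≟ j
...   | yes refl = i' , i'∈p , i≢i' ∘ sym
...   | no  i≢j  = i , i∈p , i≢j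

module _ {A B : Set} where

  padZip : A → B → List A → List B → List (A × B)
  padZip a b = alignWith (foldWithDefaults a b _,_)

  module _ {a : A} {b : B} where

    ∈-padZip⁻ : ∀ xs ys {x y} → (x , y) ∈ₗ padZip a b xs ys → (x ∈ₗ xs ⊎ x ≡ a) × (y ∈ₗ ys ⊎ y ≡ b)
    ∈-padZip⁻ [] ys m with ∈-map⁻ _ m
    ... | _ , y∈ , refl = inj₂ refl , inj₁ y∈
    ∈-padZip⁻ (_ ∷ _) [] m with ∈-map⁻ _ m
    ... | _ , x∈ , refl = inj₁ x∈ , inj₂ refl
    ∈-padZip⁻ (_ ∷ _)  (_ ∷ _)  (here refl) = inj₁ (here refl) , inj₁ (here refl)
    ∈-padZip⁻ (_ ∷ xs) (_ ∷ ys) (there m)   with ∈-padZip⁻ xs ys m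
    ... | x∈ , y∈ = Sum.map₁ there x∈ , Sum.map₁ there y∈

    ∈-padZip-either : ∀ xs ys {x y} → (x , y) ∈ₗ padZip a b xs ys → x ∈ₗ xs ⊎ y ∈ₗ ys
    ∈-padZip-either [] ys m with ∈-map⁻ _ m
    ... | _ , y∈ , refl = inj₂ y∈
    ∈-padZip-either (_ ∷ _) [] m with ∈-map⁻ _ m
    ... | _ , x∈ , refl = inj₁ x∈
    ∈-padZip-either (_ ∷ _)  (_ ∷ _)  (here refl) = inj₁ (here refl)
    ∈-padZip-either (_ ∷ xs) (_ ∷ ys) (there m)   = Sum.map there there (∈-padZip-either xs ys m)

    padZip-covers₁ : ∀ xs ys {x} → x ∈ₗ xs → ∃ λ y → (x , y) ∈ₗ padZip a b xs ys
    padZip-covers₁ (_ ∷ _)  []       x∈          = b , ∈-map⁺ _ x∈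
    padZip-covers₁ (_ ∷ _)  (y ∷ _)  (here refl) = y , here refl
    padZip-covers₁ (_ ∷ xs) (_ ∷ ys) (there x∈)  = Product.map₂ there (padZip-covers₁ xs ys x∈)

    padZip-covers₂ : ∀ xs ys {y} → y ∈ₗ ys → ∃ λ x → (x , y) ∈ₗ padZip a b xs ys
    padZip-covers₂ []       (_ ∷ _)  y∈          = a , ∈-map⁺ _ y∈
    padZip-covers₂ (x ∷ _)  (_ ∷ _)  (here refl) = x , here refl
    padZip-covers₂ (_ ∷ xs) (_ ∷ ys) (there y∈)  = Product.map₂ there (padZip-covers₂ xs ys y∈)

    padZip-unique : ∀ {xs ys} → Unique xs → Unique ys → Unique (padZip a b xs ys)
    padZip-unique {[]}    {ys} _ ys! = Unique.map⁺ (cong proj₂) ys!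
    padZip-unique {_ ∷ _} {[]} xs! _ = Unique.map⁺ (cong proj₁) xs!
    padZip-unique {_ ∷ xs} {_ ∷ ys} (x∉xs ∷ xs!) (y∉ys ∷ ys!) =
      All.tabulate (λ { m refl → [ All¬⇒¬Any x∉xs , All¬⇒¬Any y∉ys ]′ (∈-padZip-either xs ys m) })
      ∷ padZip-unique xs! ys!

  ∈-zip⁻ : ∀ (xs : List A) (ys : List B) {x y} → (x , y) ∈ₗ zip xs ys → x ∈ₗ xs × y ∈ₗ ys
  ∈-zip⁻ (_ ∷ _)  (_ ∷ _)  (here refl) = here refl , here refl
  ∈-zip⁻ (_ ∷ xs) (_ ∷ ys) (there m)   with ∈-zip⁻ xs ys m
  ... | x∈ , y∈ = there x∈ , there y∈

  map-proj₁-zip-unique : ∀ {xs : List A} (ys : List B) → Unique xs → Unique (map proj₁ (zip xs ys))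
  map-proj₁-zip-unique {[]}     _        _            = []
  map-proj₁-zip-unique {_ ∷ _}  []       _            = []
  map-proj₁-zip-unique {_ ∷ xs} (_ ∷ ys) (x∉xs ∷ xs!) =
    All.tabulate (λ x'∈ → All.lookup x∉xs (in-xs x'∈)) ∷ map-proj₁-zip-unique ys xs!
    where
    in-xs : ∀ {x} → x ∈ₗ map proj₁ (zip xs ys) → x ∈ₗ xs
    in-xs x∈ with ∈-map⁻ proj₁ x∈
    ... | _ , m , refl = proj₁ (∈-zip⁻ xs ys m)

  map-proj₂-zip-unique : ∀ (xs : List A) {ys : List B} → Unique ys → Unique (map proj₂ (zip xs ys))
  map-proj₂-zip-unique []       {_}      _            = []
  map-proj₂-zip-unique (_ ∷ _)  {[]}     _            = []
  map-proj₂-zip-unique (_ ∷ xs) {_ ∷ ys} (y∉ys ∷ ys!) =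
    All.tabulate (λ y'∈ → All.lookup y∉ys (in-ys y'∈)) ∷ map-proj₂-zip-unique xs ys!
    where
    in-ys : ∀ {y} → y ∈ₗ map proj₂ (zip xs ys) → y ∈ₗ ys
    in-ys y∈ with ∈-map⁻ proj₂ y∈
    ... | _ , m , refl = proj₂ (∈-zip⁻ xs ys m)

-- Rectangles and dispensability

module _ {V : Set} where

  -- Conditions (1) and (2) of dispensability, for X = N[x], Y = N[y] and Z = N[z].
  Dispensing : Pred V 0ℓ → Pred V 0ℓ → Pred V 0ℓ → Set
  Dispensing X Y Z = ((X ∩ Y) ⊂ (X ∩ Z) ⊎ (X ⊂ Z × Z ⊂ Y))
                   × ((X ∩ Y) ⊂ (Y ∩ Z) ⊎ (Y ⊂ Z × Z ⊂ X))

  ∩-comm : ∀ {X Y : Pred V 0ℓ} → X ∩ Y ≐ Y ∩ X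
  ∩-comm = Product.swap , Product.swap

  ∩-cong : ∀ {X X' Y Y' : Pred V 0ℓ} → X ≐ X' → Y ≐ Y' → X ∩ Y ≐ X' ∩ Y'
  ∩-cong (X⊆X' , X'⊆X) (Y⊆Y' , Y'⊆Y) =
    (λ (x , y) → X⊆X' x , Y⊆Y' y) , (λ (x' , y') → X'⊆X x' , Y'⊆Y y')

  ⊂-cong : ∀ {X X' Y Y' : Pred V 0ℓ} → X ≐ X' → Y ≐ Y' → X ⊂ Y → X' ⊂ Y'
  ⊂-cong X≐X' Y≐Y' = ⊂-respˡ-≐ X≐X' ∘ ⊂-respʳ-≐ Y≐Y'

  ∘-resp-≐ : ∀ {W : Set} {X Y : Pred V 0ℓ} (f : W → V) → X ≐ Y → X ∘ f ≐ Y ∘ f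
  ∘-resp-≐ f (X⊆Y , Y⊆X) = X⊆Y , Y⊆X

  Dispensing-cong : ∀ {X X' Y Y' Z Z' : Pred V 0ℓ} → X ≐ X' → Y ≐ Y' → Z ≐ Z' →
    Dispensing X Y Z → Dispensing X' Y' Z'
  Dispensing-cong X≐ Y≐ Z≐ (first , second) =
    Sum.map (⊂-cong (∩-cong X≐ Y≐) (∩-cong X≐ Z≐)) (Product.map (⊂-cong X≐ Z≐) (⊂-cong Z≐ Y≐)) first ,
    Sum.map (⊂-cong (∩-cong X≐ Y≐) (∩-cong Y≐ Z≐)) (Product.map (⊂-cong Y≐ Z≐) (⊂-cong Z≐ X≐)) second

  Dispensing-swap : ∀ {X Y Z : Pred V 0ℓ} → Dispensing X Y Z → Dispensing Y X Z
  Dispensing-swap (first , second) =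
    Sum.map₁ (⊂-respˡ-≐ ∩-comm) second , Sum.map₁ (⊂-respˡ-≐ ∩-comm) first

module Rectangles {V A B : Set} (c₁ : V → A) (c₂ : V → B) where

  infix 8 _⊗_
  _⊗_ : Pred A 0ℓ → Pred B 0ℓ → Pred V 0ℓ
  (X ⊗ Y) v = X (c₁ v) × Y (c₂ v)

  ⊗-∩ : ∀ {X X' Y Y'} → (X ⊗ Y) ∩ (X' ⊗ Y') ≐ (X ∩ X') ⊗ (Y ∩ Y')
  ⊗-∩ = (λ ((x , y) , (x' , y')) → (x , x') , (y , y'))
      , (λ ((x , x') , (y , y')) → (x , y) , (x' , y'))

  ⊗-mono : ∀ {X X' Y Y'} → X ⊆ X' → Y ⊆ Y' → X ⊗ Y ⊆ X' ⊗ Y'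
  ⊗-mono X⊆X' Y⊆Y' (x , y) = X⊆X' x , Y⊆Y' y

  ⊗-cong : ∀ {X X' Y Y'} → X ≐ X' → Y ≐ Y' → X ⊗ Y ≐ X' ⊗ Y'
  ⊗-cong {X} {X'} {Y} {Y'} (X⊆X' , X'⊆X) (Y⊆Y' , Y'⊆Y) =
    ⊗-mono {X} {X'} {Y} {Y'} X⊆X' Y⊆Y' , ⊗-mono {X'} {X} {Y'} {Y} X'⊆X Y'⊆Y

  module _ (pair : A → B → V) (c₁-pair : ∀ a b → c₁ (pair a b) ≡ a)
                              (c₂-pair : ∀ a b → c₂ (pair a b) ≡ b) where

    pair∈⊗ : ∀ {X Y a b} → X a → Y b → (X ⊗ Y) (pair a b)
    pair∈⊗ {X} {Y} {a} {b} x y = subst X (sym (c₁-pair a b)) x , subst Y (sym (c₂-pair a b)) y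

    pair∈⊗⁻ : ∀ {X Y a b} → (X ⊗ Y) (pair a b) → X a × Y b
    pair∈⊗⁻ {X} {Y} {a} {b} (x , y) = subst X (c₁-pair a b) x , subst Y (c₂-pair a b) y

    ⊗-⊂ˡ : ∀ {X X' Y Y'} → X ⊆ X' → Y ⊆ Y' → ¬ X' ⊆ X → Satisfiable Y → X ⊗ Y ⊂ X' ⊗ Y'
    ⊗-⊂ˡ {X} {X'} {Y} {Y'} X⊆X' Y⊆Y' X'⊈X (_ , b∈Y) = ⊗-mono {X} {X'} {Y} {Y'} X⊆X' Y⊆Y' ,
      λ ⊇ → X'⊈X λ a∈X' → proj₁ (pair∈⊗⁻ {X} {Y} (⊇ (pair∈⊗ {X'} {Y'} a∈X' (Y⊆Y' b∈Y))))

    ⊗-⊂ʳ : ∀ {X X' Y Y'} → X ⊆ X' → Y ⊆ Y' → ¬ Y' ⊆ Y → Satisfiable X → X ⊗ Y ⊂ X' ⊗ Y'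
    ⊗-⊂ʳ {X} {X'} {Y} {Y'} X⊆X' Y⊆Y' Y'⊈Y (_ , a∈X) = ⊗-mono {X} {X'} {Y} {Y'} X⊆X' Y⊆Y' ,
      λ ⊇ → Y'⊈Y λ b∈Y' → proj₂ (pair∈⊗⁻ {X} {Y} (⊇ (pair∈⊗ {X'} {Y'} (X⊆X' a∈X) b∈Y')))

    corner-dispensing : ∀ {X₁ X₂ Y₁ Y₂} → Satisfiable (X₁ ∩ X₂) → Satisfiable (Y₁ ∩ Y₂) →
      ¬ X₁ ≐ X₂ → ¬ Y₂ ⊆ Y₁ → ¬ X₁ ⊆ X₂ ⊎ (X₁ ⊆ X₂ × Y₁ ⊆ Y₂) →
      Dispensing (X₁ ⊗ Y₁) (X₂ ⊗ Y₂) (X₁ ⊗ Y₂)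
    corner-dispensing {X₁} {X₂} {Y₁} {Y₂} (a , a∈X₁ , a∈X₂) (b , b∈Y₁ , b∈Y₂) X₁≉X₂ Y₂⊈Y₁ case =
      first case , inj₁ second
      where
      meet : ∀ {X X' Y Y'} → (X₁ ∩ X₂) ⊗ (Y₁ ∩ Y₂) ⊂ (X ∩ X') ⊗ (Y ∩ Y') →
        (X₁ ⊗ Y₁) ∩ (X₂ ⊗ Y₂) ⊂ (X ⊗ Y) ∩ (X' ⊗ Y')
      meet {X} {X'} {Y} {Y'} = ⊂-cong (≐-sym (⊗-∩ {X₁} {X₂} {Y₁} {Y₂})) (≐-sym (⊗-∩ {X} {X'} {Y} {Y'}))

      first : ¬ X₁ ⊆ X₂ ⊎ (X₁ ⊆ X₂ × Y₁ ⊆ Y₂) →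
        (X₁ ⊗ Y₁) ∩ (X₂ ⊗ Y₂) ⊂ (X₁ ⊗ Y₁) ∩ (X₁ ⊗ Y₂) ⊎ (X₁ ⊗ Y₁ ⊂ X₁ ⊗ Y₂ × X₁ ⊗ Y₂ ⊂ X₂ ⊗ Y₂)
      first (inj₁ X₁⊈X₂) = inj₁ (meet {X₁} {X₁} {Y₁} {Y₂}
        (⊗-⊂ˡ {X₁ ∩ X₂} {X₁ ∩ X₁} {Y₁ ∩ Y₂} {Y₁ ∩ Y₂} (λ (x , _) → x , x) (λ y → y)
              (λ ⊇ → X₁⊈X₂ (λ x → proj₂ (⊇ (x , x)))) (b , b∈Y₁ , b∈Y₂)))
      first (inj₂ (X₁⊆X₂ , Y₁⊆Y₂)) = inj₂
        ( ⊗-⊂ʳ {X₁} {X₁} {Y₁} {Y₂} (λ x → x) Y₁⊆Y₂ Y₂⊈Y₁ (a , a∈X₁)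
        , ⊗-⊂ˡ {X₁} {X₂} {Y₂} {Y₂} X₁⊆X₂ (λ y → y) (λ X₂⊆X₁ → X₁≉X₂ (X₁⊆X₂ , X₂⊆X₁)) (b , b∈Y₂))

      second : (X₁ ⊗ Y₁) ∩ (X₂ ⊗ Y₂) ⊂ (X₂ ⊗ Y₂) ∩ (X₁ ⊗ Y₂)
      second = meet {X₂} {X₁} {Y₂} {Y₂}
        (⊗-⊂ʳ {X₁ ∩ X₂} {X₂ ∩ X₁} {Y₁ ∩ Y₂} {Y₂ ∩ Y₂} Product.swap (λ (_ , y) → y , y)
              (λ ⊇ → Y₂⊈Y₁ (λ y → proj₁ (⊇ (y , y)))) (a , a∈X₁ , a∈X₂))

    -- Inclusion of predicates is undecidable, so the case split happens under ¬ ¬; this costs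
    -- nothing, as the lemma is only used to refute non-dispensability.
    rectangles-dispensing : ∀ {X₁ X₂ Y₁ Y₂} → Satisfiable (X₁ ∩ X₂) → Satisfiable (Y₁ ∩ Y₂) →
      ¬ X₁ ≐ X₂ → ¬ Y₁ ≐ Y₂ →
      ¬ ¬ (Dispensing (X₁ ⊗ Y₁) (X₂ ⊗ Y₂) (X₁ ⊗ Y₂) ⊎ Dispensing (X₁ ⊗ Y₁) (X₂ ⊗ Y₂) (X₂ ⊗ Y₁))
    rectangles-dispensing {X₁} {X₂} {Y₁} {Y₂} common₁ common₂ X₁≉X₂ Y₁≉Y₂ neither =
      ¬¬-excluded-middle {A = Y₂ ⊆ Y₁} λ where
        (no Y₂⊈Y₁) → ¬¬-excluded-middle {A = X₁ ⊆ X₂} λ where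
          (no X₁⊈X₂)  → neither (inj₁ (corner Y₂⊈Y₁ (inj₁ X₁⊈X₂)))
          (yes X₁⊆X₂) → ¬¬-excluded-middle {A = Y₁ ⊆ Y₂} λ where
            (yes Y₁⊆Y₂) → neither (inj₁ (corner Y₂⊈Y₁ (inj₂ (X₁⊆X₂ , Y₁⊆Y₂))))
            (no Y₁⊈Y₂)  → neither (inj₂ (mirror Y₁⊈Y₂ (inj₁ λ X₂⊆X₁ → X₁≉X₂ (X₁⊆X₂ , X₂⊆X₁))))
        (yes Y₂⊆Y₁) → ¬¬-excluded-middle {A = X₂ ⊆ X₁} λ where
          (yes X₂⊆X₁) → neither (inj₂ (mirror (λ Y₁⊆Y₂ → Y₁≉Y₂ (Y₁⊆Y₂ , Y₂⊆Y₁)) (inj₂ (X₂⊆X₁ , Y₂⊆Y₁))))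
          (no X₂⊈X₁)  → neither (inj₂ (mirror (λ Y₁⊆Y₂ → Y₁≉Y₂ (Y₁⊆Y₂ , Y₂⊆Y₁)) (inj₁ X₂⊈X₁)))
      where
      corner = corner-dispensing {X₁} {X₂} {Y₁} {Y₂} common₁ common₂ X₁≉X₂

      mirror : ¬ Y₁ ⊆ Y₂ → ¬ X₂ ⊆ X₁ ⊎ (X₂ ⊆ X₁ × Y₂ ⊆ Y₁) →
        Dispensing (X₁ ⊗ Y₁) (X₂ ⊗ Y₂) (X₂ ⊗ Y₁)
      mirror Y₁⊈Y₂ = Dispensing-swap ∘ corner-dispensing {X₂} {X₁} {Y₂} {Y₁}
        (Product.map₂ Product.swap common₁) (Product.map₂ Product.swap common₂) (X₁≉X₂ ∘ ≐-sym) Y₁⊈Y₂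

module _ {n} {H : Hypergraph n} where

  N-sym : ∀ {u w} → (N[ u ] H) w → (N[ w ] H) u
  N-sym (inj₁ refl)                  = inj₁ refl
  N-sym (inj₂ (e , e∈E , u∈e , w∈e)) = inj₂ (e , e∈E , w∈e , u∈e)

  edge-between : ∀ {u w} → (N[ u ] H) w → u ≢ w → ∃ λ e → Edge H e × u ∈ e × w ∈ e
  edge-between (inj₁ u≡w) u≢w = contradiction u≡w u≢w
  edge-between (inj₂ shared) _ = shared

module _ {n m} (σ : Fin n ↔ Fin m) where
  open Inverse σ

  ∈-image⁺ : ∀ {e u} → u ∈ e → to u ∈ image σ e
  ∈-image⁺ {e} {u} u∈e = ∈-subset⁺ (λ j → from j ∈? e) (subst (_∈ e) (sym (strictlyInverseʳ u)) u∈e)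

  ∈-image⁻ : ∀ {e v} → v ∈ image σ e → from v ∈ e
  ∈-image⁻ {e} = ∈-subset⁻ (λ j → from j ∈? e)

  preimage : Subset m → Subset n
  preimage g = subset (λ i → to i ∈? g)

  image-preimage : ∀ g → image σ (preimage g) ≡ g
  image-preimage g = ⊆-antisym
    (λ {v} v∈ → subst (_∈ g) (strictlyInverseˡ v) (∈-subset⁻ (λ i → to i ∈? g) (∈-image⁻ v∈)))
    (λ {v} v∈g → ∈-subset⁺ (λ j → from j ∈? preimage g)
                   (∈-subset⁺ (λ i → to i ∈? g) (subst (_∈ g) (sym (strictlyInverseˡ v)) v∈g)))

  N-iso : ∀ {H : Hypergraph n} {H' : Hypergraph m} → IsIso H H' σ → ∀ v → N[ v ] H ≐ (N[ to v ] H') ∘ to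
  N-iso {H} {H'} iso v = forth , back
    where
    forth : ∀ {w} → (N[ v ] H) w → (N[ to v ] H') (to w)
    forth (inj₁ refl)                  = inj₁ refl
    forth (inj₂ (e , e∈E , v∈e , w∈e)) = inj₂ (image σ e , proj₁ (iso e) e∈E , ∈-image⁺ v∈e , ∈-image⁺ w∈e)
    back : ∀ {w} → (N[ to v ] H') (to w) → (N[ v ] H) w
    back {w} (inj₁ tv≡tw) =
      inj₁ (trans (sym (strictlyInverseʳ v)) (trans (cong from tv≡tw) (strictlyInverseʳ w)))
    back (inj₂ (g , g∈E , tv∈g , tw∈g)) =
      inj₂ (preimage g , proj₂ (iso (preimage g)) (subst (Edge H') (sym (image-preimage g)) g∈E)
           , ∈-subset⁺ (λ i → to i ∈? g) tv∈g , ∈-subset⁺ (λ i → to i ∈? g) tw∈g)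

-- Products

module Coordinates (n₁ n₂ : ℕ) where

  π₁ : Fin (n₁ * n₂) → Fin n₁
  π₁ v = proj₁ (remQuot {n₁} n₂ v)

  π₂ : Fin (n₁ * n₂) → Fin n₂
  π₂ v = proj₂ (remQuot {n₁} n₂ v)

  π₁-combine : ∀ a b → π₁ (combine a b) ≡ a
  π₁-combine a b = cong proj₁ (remQuot-combine {n₁} {n₂} a b)

  π₂-combine : ∀ a b → π₂ (combine a b) ≡ b
  π₂-combine a b = cong proj₂ (remQuot-combine {n₁} {n₂} a b)

  combine-π : ∀ v → combine (π₁ v) (π₂ v) ≡ v
  combine-π = combine-remQuot {n₁} n₂

  π-injective : ∀ {v w} → π₁ v ≡ π₁ w → π₂ v ≡ π₂ w → v ≡ w
  π-injective {v} {w} π₁≡ π₂≡ = trans (sym (combine-π v)) (trans (cong₂ combine π₁≡ π₂≡) (combine-π w))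

  uncurry-combine-injective : ∀ {ab cd : Fin n₁ × Fin n₂} → uncurry combine ab ≡ uncurry combine cd → ab ≡ cd
  uncurry-combine-injective {a , b} {c , d} eq = uncurry (cong₂ _,_) (combine-injective a b c d eq)

  open Rectangles π₁ π₂ public

  pr₁ : Subset (n₁ * n₂) → Subset n₁
  pr₁ = p₁ n₁ n₂

  pr₂ : Subset (n₁ * n₂) → Subset n₂
  pr₂ = p₂ n₁ n₂

  module _ {f : Subset (n₁ * n₂)} where

    ∈-pr₁⁺ : ∀ {v} → v ∈ f → π₁ v ∈ pr₁ f
    ∈-pr₁⁺ {v} v∈f = ∈-subset⁺ (λ a → any? λ v → (v ∈? f) ×-dec (π₁ v ≟ a)) (v , v∈f , refl)

    ∈-pr₂⁺ : ∀ {v} → v ∈ f → π₂ v ∈ pr₂ f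
    ∈-pr₂⁺ {v} v∈f = ∈-subset⁺ (λ b → any? λ v → (v ∈? f) ×-dec (π₂ v ≟ b)) (v , v∈f , refl)

    ∈-pr₁⁻ : ∀ {a} → a ∈ pr₁ f → ∃ λ v → v ∈ f × π₁ v ≡ a
    ∈-pr₁⁻ = ∈-subset⁻ (λ a → any? λ v → (v ∈? f) ×-dec (π₁ v ≟ a))

    ∈-pr₂⁻ : ∀ {b} → b ∈ pr₂ f → ∃ λ v → v ∈ f × π₂ v ≡ b
    ∈-pr₂⁻ = ∈-subset⁻ (λ b → any? λ v → (v ∈? f) ×-dec (π₂ v ≟ b))

  diagonal-pair : ∀ {g} → 2 ≤ ∣ pr₁ g ∣ → 2 ≤ ∣ pr₂ g ∣ →
    ∃₂ λ x y → x ∈ g × y ∈ g × π₁ x ≢ π₁ y × π₂ x ≢ π₂ y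
  diagonal-pair {g} 2≤∣pr₁∣ 2≤∣pr₂∣ with 2≤∣p∣⇒two-members 2≤∣pr₁∣
  ... | _ , _ , a∈ , a'∈ , a≢a' with ∈-pr₁⁻ a∈ | ∈-pr₁⁻ a'∈
  ... | u , u∈g , refl | u' , u'∈g , refl with π₂ u ≟ π₂ u'
  ... | no  π₂≢ = u , u' , u∈g , u'∈g , a≢a' , π₂≢
  ... | yes π₂≡ with 2≤∣p∣⇒member-≢ 2≤∣pr₂∣ (π₂ u)
  ... | _ , b∈ , b≢ with ∈-pr₂⁻ b∈
  ... | w , w∈g , refl with π₁ w ≟ π₁ u
  ... | yes π₁≡ = w , u' , w∈g , u'∈g , a≢a' ∘ trans (sym π₁≡) , b≢ ∘ flip trans (sym π₂≡)
  ... | no  π₁≢ = w , u , w∈g , u∈g , π₁≢ , b≢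

  infix 8 _×ˢ_
  _×ˢ_ : Subset n₁ → Subset n₂ → Subset (n₁ * n₂)
  s ×ˢ t = subset (λ v → (π₁ v ∈? s) ×-dec (π₂ v ∈? t))

  module _ {s : Subset n₁} {t : Subset n₂} where

    ∈-×ˢ⁺ : ∀ {v} → π₁ v ∈ s → π₂ v ∈ t → v ∈ s ×ˢ t
    ∈-×ˢ⁺ π₁∈s π₂∈t = ∈-subset⁺ (λ v → (π₁ v ∈? s) ×-dec (π₂ v ∈? t)) (π₁∈s , π₂∈t)

    ∈-×ˢ⁻ : ∀ {v} → v ∈ s ×ˢ t → π₁ v ∈ s × π₂ v ∈ t
    ∈-×ˢ⁻ = ∈-subset⁻ (λ v → (π₁ v ∈? s) ×-dec (π₂ v ∈? t))

    combine∈×ˢ : ∀ {a b} → a ∈ s → b ∈ t → combine a b ∈ s ×ˢ t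
    combine∈×ˢ {a} {b} a∈s b∈t =
      ∈-×ˢ⁺ (subst (_∈ s) (sym (π₁-combine a b)) a∈s) (subst (_∈ t) (sym (π₂-combine a b)) b∈t)

    pr₁-×ˢ : ∀ {b} → b ∈ t → pr₁ (s ×ˢ t) ≡ s
    pr₁-×ˢ {b} b∈t = ⊆-antisym
      (λ a∈ → let v , v∈ , π₁v≡a = ∈-pr₁⁻ a∈ in subst (_∈ s) π₁v≡a (proj₁ (∈-×ˢ⁻ v∈)))
      (λ {a} a∈s → subst (_∈ pr₁ (s ×ˢ t)) (π₁-combine a b) (∈-pr₁⁺ (combine∈×ˢ a∈s b∈t)))

    pr₂-×ˢ : ∀ {a} → a ∈ s → pr₂ (s ×ˢ t) ≡ t
    pr₂-×ˢ {a} a∈s = ⊆-antisym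
      (λ b∈ → let v , v∈ , π₂v≡b = ∈-pr₂⁻ b∈ in subst (_∈ t) π₂v≡b (proj₂ (∈-×ˢ⁻ v∈)))
      (λ {b} b∈t → subst (_∈ pr₂ (s ×ˢ t)) (π₂-combine a b) (∈-pr₂⁺ (combine∈×ˢ a∈s b∈t)))

  fromPairs : List (Fin n₁ × Fin n₂) → Subset (n₁ * n₂)
  fromPairs ps = fromList (map (uncurry combine) ps)

  module _ {ps : List (Fin n₁ × Fin n₂)} where

    ∈-fromPairs⁺ : ∀ {a b} → (a , b) ∈ₗ ps → combine a b ∈ fromPairs ps
    ∈-fromPairs⁺ ab∈ = ∈-fromList⁺ (∈-map⁺ (uncurry combine) ab∈)

    ∈-fromPairs⁻ : ∀ {v} → v ∈ fromPairs ps → (π₁ v , π₂ v) ∈ₗ ps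
    ∈-fromPairs⁻ v∈ with ∈-map⁻ (uncurry (combine {n₁} {n₂})) {xs = ps} (∈-fromList⁻ v∈)
    ... | (a , b) , ab∈ , refl = subst (_∈ₗ ps) (sym (remQuot-combine a b)) ab∈

    ∣fromPairs∣≡length : Unique ps → ∣ fromPairs ps ∣ ≡ length ps
    ∣fromPairs∣≡length ps! = trans
      (∣fromList∣≡length (Unique.map⁺ uncurry-combine-injective ps!))
      (length-map (uncurry combine) ps)

    ∈-pr₁-fromPairs⁺ : ∀ {a b} → (a , b) ∈ₗ ps → a ∈ pr₁ (fromPairs ps)
    ∈-pr₁-fromPairs⁺ {a} {b} ab∈ = subst (_∈ pr₁ (fromPairs ps)) (π₁-combine a b) (∈-pr₁⁺ (∈-fromPairs⁺ ab∈))

    ∈-pr₂-fromPairs⁺ : ∀ {a b} → (a , b) ∈ₗ ps → b ∈ pr₂ (fromPairs ps)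
    ∈-pr₂-fromPairs⁺ {a} {b} ab∈ = subst (_∈ pr₂ (fromPairs ps)) (π₂-combine a b) (∈-pr₂⁺ (∈-fromPairs⁺ ab∈))

    ∈-pr₁-fromPairs⁻ : ∀ {a} → a ∈ pr₁ (fromPairs ps) → ∃ λ b → (a , b) ∈ₗ ps
    ∈-pr₁-fromPairs⁻ a∈ with ∈-pr₁⁻ a∈
    ... | v , v∈ , refl = π₂ v , ∈-fromPairs⁻ v∈

    ∈-pr₂-fromPairs⁻ : ∀ {b} → b ∈ pr₂ (fromPairs ps) → ∃ λ a → (a , b) ∈ₗ ps
    ∈-pr₂-fromPairs⁻ b∈ with ∈-pr₂⁻ b∈
    ... | v , v∈ , refl = π₁ v , ∈-fromPairs⁻ v∈

    ∣pr₁-fromPairs∣≡length : Unique (map proj₁ ps) → ∣ pr₁ (fromPairs ps) ∣ ≡ length ps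
    ∣pr₁-fromPairs∣≡length ps₁! = trans (∣s∣≡length enumeration) (length-map proj₁ ps)
      where
      sound′ : ∀ {a} → ∃ (λ ab → ab ∈ₗ ps × a ≡ proj₁ ab) → a ∈ pr₁ (fromPairs ps)
      sound′ (_ , ab∈ , refl) = ∈-pr₁-fromPairs⁺ ab∈
      enumeration : Enumerates (pr₁ (fromPairs ps)) (map proj₁ ps)
      enumeration = record
        { unique   = ps₁!
        ; complete = λ a∈ → ∈-map⁺ proj₁ (proj₂ (∈-pr₁-fromPairs⁻ a∈))
        ; sound    = sound′ ∘ ∈-map⁻ proj₁
        }


    ∣pr₂-fromPairs∣≡length : Unique (map proj₂ ps) → ∣ pr₂ (fromPairs ps) ∣ ≡ length ps
    ∣pr₂-fromPairs∣≡length ps₂! = trans (∣s∣≡length enumeration) (length-map proj₂ ps)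
      where
      sound′ : ∀ {b} → ∃ (λ ab → ab ∈ₗ ps × b ≡ proj₂ ab) → b ∈ pr₂ (fromPairs ps)
      sound′ (_ , ab∈ , refl) = ∈-pr₂-fromPairs⁺ ab∈
      enumeration : Enumerates (pr₂ (fromPairs ps)) (map proj₂ ps)
      enumeration = record
        { unique   = ps₂!
        ; complete = λ b∈ → ∈-map⁺ proj₂ (proj₂ (∈-pr₂-fromPairs⁻ b∈))
        ; sound    = sound′ ∘ ∈-map⁻ proj₂
        }

  ∈-fromPairs-heads : ∀ {a b a' b'} ps →
    let qs = (a , b) ∷ (a' , b') ∷ ps in combine a b ∈ fromPairs qs × combine a' b' ∈ fromPairs qs
  ∈-fromPairs-heads {a} {b} {a'} {b'} ps =
    ∈-fromPairs⁺ {qs} (here refl) , ∈-fromPairs⁺ {qs} (there (here refl))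
    where qs = (a , b) ∷ (a' , b') ∷ ps

module ProductEdges {n₁ n₂} (H₁ : Hypergraph n₁) (H₂ : Hypergraph n₂) where
  open Coordinates n₁ n₂

  cartesian⇒product : ∀ k {g} → Edge (H₁ □ H₂) g → Edge (product k H₁ H₂) g
  cartesian⇒product normal = inj₁
  cartesian⇒product strong = inj₁

  layer₁-edge : ∀ {e a} b → Edge H₁ e → a ∈ e → Edge (H₁ □ H₂) (e ×ˢ ⁅ b ⁆)
  layer₁-edge b e∈E a∈e =
    inj₁ (subst (Edge H₁) (sym (pr₁-×ˢ (x∈⁅x⁆ b))) e∈E , trans (cong ∣_∣ (pr₂-×ˢ a∈e)) (∣⁅x⁆∣≡1 b))

  layer₂-edge : ∀ a {e b} → Edge H₂ e → b ∈ e → Edge (H₁ □ H₂) (⁅ a ⁆ ×ˢ e)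
  layer₂-edge a e∈E b∈e =
    inj₂ (subst (Edge H₂) (sym (pr₂-×ˢ (x∈⁅x⁆ a))) e∈E , trans (cong ∣_∣ (pr₁-×ˢ b∈e)) (∣⁅x⁆∣≡1 a))

  module _ {e₁ e₂ xs ys} (e₁∈E : Edge H₁ e₁) (e₂∈E : Edge H₂ e₂)
           (xs-enum : Enumerates e₁ xs) (ys-enum : Enumerates e₂ ys) where

    strong-diagonal-edge : ∀ {a b} → a ∈ e₁ → b ∈ e₂ → Edge (H₁ ⊠max H₂) (fromPairs (padZip a b xs ys))
    strong-diagonal-edge {a} {b} a∈e₁ b∈e₂ =
      inj₂ (subst (Edge H₁) (sym pr₁≡e₁) e₁∈E , subst (Edge H₂) (sym pr₂≡e₂) e₂∈E , size)
      where
      ps = padZip a b xs ys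
      pr₁≡e₁ : pr₁ (fromPairs ps) ≡ e₁
      pr₁≡e₁ = ⊆-antisym
        (λ x∈ → [ sound xs-enum , (λ { refl → a∈e₁ }) ]′
                  (proj₁ (∈-padZip⁻ xs ys (proj₂ (∈-pr₁-fromPairs⁻ {ps} x∈)))))
        (λ x∈ → ∈-pr₁-fromPairs⁺ (proj₂ (padZip-covers₁ xs ys (complete xs-enum x∈))))
      pr₂≡e₂ : pr₂ (fromPairs ps) ≡ e₂
      pr₂≡e₂ = ⊆-antisym
        (λ y∈ → [ sound ys-enum , (λ { refl → b∈e₂ }) ]′
                  (proj₂ (∈-padZip⁻ xs ys (proj₂ (∈-pr₂-fromPairs⁻ {ps} y∈)))))
        (λ y∈ → ∈-pr₂-fromPairs⁺ (proj₂ (padZip-covers₂ xs ys (complete ys-enum y∈))))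
      open ≡-Reasoning
      size : ∣ fromPairs ps ∣ ≡ ∣ pr₁ (fromPairs ps) ∣ ⊔ ∣ pr₂ (fromPairs ps) ∣
      size = begin
        ∣ fromPairs ps ∣
          ≡⟨ ∣fromPairs∣≡length (padZip-unique (unique xs-enum) (unique ys-enum)) ⟩
        length ps
          ≡⟨ length-alignWith xs ys ⟩
        length xs ⊔ length ys
          ≡⟨ sym (cong₂ _⊔_ (∣s∣≡length xs-enum) (∣s∣≡length ys-enum)) ⟩
        ∣ e₁ ∣ ⊔ ∣ e₂ ∣
          ≡⟨ sym (cong₂ (λ s t → ∣ s ∣ ⊔ ∣ t ∣) pr₁≡e₁ pr₂≡e₂) ⟩
        ∣ pr₁ (fromPairs ps) ∣ ⊔ ∣ pr₂ (fromPairs ps) ∣ ∎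

    normal-diagonal-edge : Edge (H₁ ⊠min H₂) (fromPairs (zip xs ys))
    normal-diagonal-edge = inj₂
      ( e₁ , e₂ , e₁∈E , e₂∈E
      , (λ x∈ → sound xs-enum (proj₁ (∈-zip⁻ xs ys (proj₂ (∈-pr₁-fromPairs⁻ {ps} x∈)))))
      , (λ y∈ → sound ys-enum (proj₂ (∈-zip⁻ xs ys (proj₂ (∈-pr₂-fromPairs⁻ {ps} y∈)))))
      , trans size (sym (∣pr₁-fromPairs∣≡length ps₁!))
      , trans size (sym (∣pr₂-fromPairs∣≡length ps₂!))
      , trans size (trans (length-zipWith _,_ xs ys)
                          (sym (cong₂ _⊓_ (∣s∣≡length xs-enum) (∣s∣≡length ys-enum)))))
      where
      ps = zip xs ys
      ps₁! = map-proj₁-zip-unique ys (unique xs-enum)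
      ps₂! = map-proj₂-zip-unique xs (unique ys-enum)
      size : ∣ fromPairs ps ∣ ≡ length ps
      size = ∣fromPairs∣≡length (Unique.map⁻ ps₁!)

  diagonal-edge : ∀ k {e₁ e₂ a a' b b' xs ys} → Edge H₁ e₁ → Edge H₂ e₂ →
    Enumerates e₁ (a ∷ a' ∷ xs) → Enumerates e₂ (b ∷ b' ∷ ys) →
    ∃ λ g → Edge (product k H₁ H₂) g × combine a b ∈ g × combine a' b' ∈ g
  diagonal-edge normal {xs = xs} {ys} e₁∈E e₂∈E xs-enum ys-enum =
    _ , normal-diagonal-edge e₁∈E e₂∈E xs-enum ys-enum , ∈-fromPairs-heads (zip xs ys)
  diagonal-edge strong {a = a} {b = b} {xs = xs} {ys} e₁∈E e₂∈E xs-enum ys-enum =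
    _ , strong-diagonal-edge e₁∈E e₂∈E xs-enum ys-enum (sound xs-enum (here refl))
                                                         (sound ys-enum (here refl))
      , ∈-fromPairs-heads (padZip a b xs ys)

  N-product⁺ : ∀ k {u w} → (N[ u ] product k H₁ H₂) w → (N[ π₁ u ] H₁ ⊗ N[ π₂ u ] H₂) w
  N-product⁺ k (inj₁ refl)                  = inj₁ refl , inj₁ refl
  N-product⁺ k {u} {w} (inj₂ (g , g∈E , u∈g , w∈g)) = projections k g∈E
    where
    both : ∀ {e₁ e₂} → Edge H₁ e₁ → Edge H₂ e₂ → pr₁ g ⊆ˢ e₁ → pr₂ g ⊆ˢ e₂ → (N[ π₁ u ] H₁ ⊗ N[ π₂ u ] H₂) w
    both e₁∈E e₂∈E ⊆e₁ ⊆e₂ = inj₂ (_ , e₁∈E , ⊆e₁ (∈-pr₁⁺ u∈g) , ⊆e₁ (∈-pr₁⁺ w∈g))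
                           , inj₂ (_ , e₂∈E , ⊆e₂ (∈-pr₂⁺ u∈g) , ⊆e₂ (∈-pr₂⁺ w∈g))
    cartesian : Edge (H₁ □ H₂) g → (N[ π₁ u ] H₁ ⊗ N[ π₂ u ] H₂) w
    cartesian (inj₁ (pr₁∈E , ∣pr₂∣≡1)) =
      inj₂ (pr₁ g , pr₁∈E , ∈-pr₁⁺ u∈g , ∈-pr₁⁺ w∈g) , inj₁ (∣p∣≡1⇒x≡y ∣pr₂∣≡1 (∈-pr₂⁺ u∈g) (∈-pr₂⁺ w∈g))
    cartesian (inj₂ (pr₂∈E , ∣pr₁∣≡1)) =
      inj₁ (∣p∣≡1⇒x≡y ∣pr₁∣≡1 (∈-pr₁⁺ u∈g) (∈-pr₁⁺ w∈g)) , inj₂ (pr₂ g , pr₂∈E , ∈-pr₂⁺ u∈g , ∈-pr₂⁺ w∈g)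
    projections : ∀ k → Edge (product k H₁ H₂) g → (N[ π₁ u ] H₁ ⊗ N[ π₂ u ] H₂) w
    projections normal (inj₁ c) = cartesian c
    projections strong (inj₁ c) = cartesian c
    projections normal (inj₂ (_ , _ , e₁∈E , e₂∈E , ⊆e₁ , ⊆e₂ , _)) = both e₁∈E e₂∈E ⊆e₁ ⊆e₂
    projections strong (inj₂ (pr₁∈E , pr₂∈E , _)) = both pr₁∈E pr₂∈E (λ x → x) (λ y → y)

  N-product⁻ : ∀ k {u w} → (N[ π₁ u ] H₁ ⊗ N[ π₂ u ] H₂) w → (N[ u ] product k H₁ H₂) w
  N-product⁻ k {u} {w} (u₁~w₁ , u₂~w₂) with π₁ u ≟ π₁ w | π₂ u ≟ π₂ w
  ... | yes π₁≡ | yes π₂≡ = inj₁ (π-injective π₁≡ π₂≡)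
  ... | yes π₁≡ | no  π₂≢ =
    let e , e∈E , u₂∈e , w₂∈e = edge-between u₂~w₂ π₂≢
    in inj₂ (_ , cartesian⇒product k (layer₂-edge (π₁ u) e∈E u₂∈e)
            , ∈-×ˢ⁺ (x∈⁅x⁆ _) u₂∈e , ∈-×ˢ⁺ (subst (_∈ ⁅ π₁ u ⁆) π₁≡ (x∈⁅x⁆ _)) w₂∈e)
  ... | no  π₁≢ | yes π₂≡ =
    let e , e∈E , u₁∈e , w₁∈e = edge-between u₁~w₁ π₁≢
    in inj₂ (_ , cartesian⇒product k (layer₁-edge (π₂ u) e∈E u₁∈e)
            , ∈-×ˢ⁺ u₁∈e (x∈⁅x⁆ _) , ∈-×ˢ⁺ w₁∈e (subst (_∈ ⁅ π₂ u ⁆) π₂≡ (x∈⁅x⁆ _)))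
  ... | no  π₁≢ | no  π₂≢ =
    let e₁ , e₁∈E , u₁∈e₁ , w₁∈e₁ = edge-between u₁~w₁ π₁≢
        e₂ , e₂∈E , u₂∈e₂ , w₂∈e₂ = edge-between u₂~w₂ π₂≢
        g , g∈E , uu∈g , ww∈g = diagonal-edge k e₁∈E e₂∈E
          (proj₂ (enumerate-from u₁∈e₁ w₁∈e₁ π₁≢)) (proj₂ (enumerate-from u₂∈e₂ w₂∈e₂ π₂≢))
    in inj₂ (g , g∈E , subst (_∈ g) (combine-π u) uu∈g , subst (_∈ g) (combine-π w) ww∈g)

  N-product : ∀ k u → N[ u ] product k H₁ H₂ ≐ N[ π₁ u ] H₁ ⊗ N[ π₂ u ] H₂
  N-product k u = N-product⁺ k , N-product⁻ k

  cartesian-or-spread : ∀ k {g} → Simple H₁ → Simple H₂ → Edge (product k H₁ H₂) g →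
    Edge (H₁ □ H₂) g ⊎ (2 ≤ ∣ pr₁ g ∣ × 2 ≤ ∣ pr₂ g ∣)
  cartesian-or-spread normal _ _ (inj₁ cartesian) = inj₁ cartesian
  cartesian-or-spread strong _ _ (inj₁ cartesian) = inj₁ cartesian
  cartesian-or-spread strong (2≤∣E₁∣ , _) (2≤∣E₂∣ , _) (inj₂ (pr₁∈E , pr₂∈E , _)) =
    inj₂ (2≤∣E₁∣ _ pr₁∈E , 2≤∣E₂∣ _ pr₂∈E)
  cartesian-or-spread normal (2≤∣E₁∣ , _) (2≤∣E₂∣ , _)
    (inj₂ (e₁ , e₂ , e₁∈E , e₂∈E , _ , _ , ∣g∣≡∣pr₁∣ , ∣g∣≡∣pr₂∣ , ∣g∣≡⊓)) =
    inj₂ (subst (2 ≤_) (trans (sym ∣g∣≡⊓) ∣g∣≡∣pr₁∣) 2≤⊓ , subst (2 ≤_) (trans (sym ∣g∣≡⊓) ∣g∣≡∣pr₂∣) 2≤⊓)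
    where
    2≤⊓ = ⊓-glb (2≤∣E₁∣ e₁ e₁∈E) (2≤∣E₂∣ e₂ e₂∈E)

-- Hypergraphs whose neighbourhoods are rectangles

module Factorisation {n n₁ n₂} (H : Hypergraph n) (H₁ : Hypergraph n₁) (H₂ : Hypergraph n₂)
  (c₁ : Fin n → Fin n₁) (c₂ : Fin n → Fin n₂) (pair : Fin n₁ → Fin n₂ → Fin n)
  (c₁-pair : ∀ a b → c₁ (pair a b) ≡ a) (c₂-pair : ∀ a b → c₂ (pair a b) ≡ b) where
  open Rectangles c₁ c₂

  module _ (N-split : ∀ v → N[ v ] H ≐ N[ c₁ v ] H₁ ⊗ N[ c₂ v ] H₂) where

    N-pair : ∀ a b → N[ pair a b ] H ≐ N[ a ] H₁ ⊗ N[ b ] H₂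
    N-pair a b = subst₂ (λ a' b' → N[ pair a b ] H ≐ N[ a' ] H₁ ⊗ N[ b' ] H₂)
                        (c₁-pair a b) (c₂-pair a b) (N-split (pair a b))

    thin₁ : Thin H → Fin n₂ → Thin H₁
    thin₁ thin b a a' a≢a' Na≐Na' = thin (pair a b) (pair a' b) pair≢
      (≐-trans (N-pair a b) (≐-trans (⊗-cong {N[ a ] H₁} {N[ a' ] H₁} {N[ b ] H₂} Na≐Na' ≐-refl)
                                    (≐-sym (N-pair a' b))))
      where
      pair≢ : pair a b ≢ pair a' b
      pair≢ eq = a≢a' (trans (sym (c₁-pair a b)) (trans (cong c₁ eq) (c₁-pair a' b)))

    thin₂ : Thin H → Fin n₁ → Thin H₂
    thin₂ thin a b b' b≢b' Nb≐Nb' = thin (pair a b) (pair a b') pair≢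
      (≐-trans (N-pair a b) (≐-trans (⊗-cong {N[ a ] H₁} {N[ a ] H₁} {N[ b ] H₂} ≐-refl Nb≐Nb')
                                    (≐-sym (N-pair a b'))))
      where
      pair≢ : pair a b ≢ pair a b'
      pair≢ eq = b≢b' (trans (sym (c₂-pair a b)) (trans (cong c₂ eq) (c₂-pair a b')))

    dispensable-if-diagonal : Thin H → ∀ {e x y} → Edge H e → x ∈ e → y ∈ e →
      c₁ x ≢ c₁ y → c₂ x ≢ c₂ y → ¬ ¬ Dispensable H e
    dispensable-if-diagonal thin {e} {x} {y} e∈E x∈e y∈e c₁≢ c₂≢ ¬dispensable =
      rectangles-dispensing pair c₁-pair c₂-pair {A₁} {A₂} {B₁} {B₂}
        (c₁ x , inj₁ refl , N-sym (proj₁ x~y)) (c₂ x , inj₁ refl , N-sym (proj₂ x~y))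
        (thin₁ thin (c₂ x) _ _ c₁≢) (thin₂ thin (c₁ x) _ _ c₂≢) λ where
          (inj₁ D) → ¬dispensable (pair (c₁ x) (c₂ y) , x , y , x∈e , y∈e , x≢y , realise (N-pair _ _) D)
          (inj₂ D) → ¬dispensable (pair (c₁ y) (c₂ x) , x , y , x∈e , y∈e , x≢y , realise (N-pair _ _) D)
      where
      A₁ = N[ c₁ x ] H₁
      A₂ = N[ c₁ y ] H₁
      B₁ = N[ c₂ x ] H₂
      B₂ = N[ c₂ y ] H₂
      x~y : (A₁ ⊗ B₁) y
      x~y = proj₁ (N-split x) (inj₂ (e , e∈E , x∈e , y∈e))
      x≢y : x ≢ y
      x≢y = c₁≢ ∘ cong c₁
      realise : ∀ {z Z} → N[ z ] H ≐ Z →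
        Dispensing (A₁ ⊗ B₁) (A₂ ⊗ B₂) Z → Dispensing (N[ x ] H) (N[ y ] H) (N[ z ] H)
      realise Nz≐Z = Dispensing-cong (≐-sym (N-split x)) (≐-sym (N-split y)) (≐-sym Nz≐Z)

lemma3p8 : (k : ProductKind) {n n₁ n₂ : ℕ}
    (H : Hypergraph n) (H₁ : Hypergraph n₁) (H₂ : Hypergraph n₂) →
    IsHypergraph H → IsHypergraph H₁ → IsHypergraph H₂ →
    Thin H →
    (σ : Fin n ↔ Fin (n₁ * n₂)) → IsIso H (product k H₁ H₂) σ →
    (e : Subset n) → Edge H e → ¬ Dispensable H e →
    Edge (H₁ □ H₂) (image σ e)
lemma3p8 k {n} {n₁} {n₂} H H₁ H₂ _ (simple₁ , _) (simple₂ , _) thin σ iso e e∈E ¬dispensable =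
  Sum.fromInj₁ spread-impossible (cartesian-or-spread k simple₁ simple₂ (proj₁ (iso e) e∈E))
  where
  open Inverse σ
  open Coordinates n₁ n₂
  open ProductEdges H₁ H₂
  open Factorisation H H₁ H₂ (π₁ ∘ to) (π₂ ∘ to) (λ a b → from (combine a b))
    (λ a b → trans (cong π₁ (strictlyInverseˡ _)) (π₁-combine a b))
    (λ a b → trans (cong π₂ (strictlyInverseˡ _)) (π₂-combine a b))

  N-split : ∀ v → N[ v ] H ≐ (N[ π₁ (to v) ] H₁ ⊗ N[ π₂ (to v) ] H₂) ∘ to
  N-split v = ≐-trans (N-iso σ iso v) (∘-resp-≐ to (N-product k (to v)))

  coordinates-from : ∀ {A : Set} (c : Fin (n₁ * n₂) → A) {v w} →
    c (to (from v)) ≡ c (to (from w)) → c v ≡ c w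
  coordinates-from c {v} {w} = subst₂ (λ v' w' → c v' ≡ c w') (strictlyInverseˡ v) (strictlyInverseˡ w)

  spread-impossible : 2 ≤ ∣ pr₁ (image σ e) ∣ × 2 ≤ ∣ pr₂ (image σ e) ∣ → Edge (H₁ □ H₂) (image σ e)
  spread-impossible (2≤∣pr₁∣ , 2≤∣pr₂∣) =
    let x , y , x∈ , y∈ , π₁≢ , π₂≢ = diagonal-pair 2≤∣pr₁∣ 2≤∣pr₂∣
    in ⊥-elim (dispensable-if-diagonal N-split thin e∈E (∈-image⁻ σ x∈) (∈-image⁻ σ y∈)
                 (π₁≢ ∘ coordinates-from π₁) (π₂≢ ∘ coordinates-from π₂) ¬dispensable)
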